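{- Let $T\in\mathbf{LT}$ and $h\in\mathrm{spl}(T)$. Then (i) if $u,v\in 2^h\cap T$ then $T{\restriction}v=(u\cdot v)\cdot(T{\restriction}u)$ and $(u\cdot v)\cdot T=T$; (ii) if $\sigma\in 2^{<\omega}$ then either $T=\sigma\cdot T$ or $T\cap(\sigma\cdot T)$ is finite.
   Context: $2^{<\omega}$ is the set of finite binary strings, $\mathrm{lh}(s)$ the length, $2^n$ the strings of length $n$, $s^\frown t$ concatenation. For $s,t\in 2^{<\omega}$ with $\mathrm{lh}(s)\le\mathrm{lh}(t)$, $s\cdot t$ is the string of length $\mathrm{lh}(t)$ with $(s\cdot t)(k)=t(k)+s(k)\bmod 2$ for $k<\mathrm{lh}(s)$ and $(s\cdot t)(k)=t(k)$ otherwise; if $\mathrm{lh}(s)>\mathrm{lh}(t)$ then $s\cdot t=(s{\restriction}\mathrm{lh}(t))\cdot t$. For $T\subseteq 2^{<\omega}$, $s\cdot T=\{s\cdot t:t\in T\}$ and $T{\restriction}s=\{t\in T: s\subseteq t\lor t\subseteq s\}$. A perfect tree is a nonempty tree $T\subseteq 2^{<\omega}$ with no endpoints and no isolated branches; its stem $\mathrm{stem}(T)$ is the largest $s\in T$ with $T=T{\restriction}s$. $\mathbf{LT}$ is the set of perfect trees $T$ for which there are nonempty strings $q^n_i$ ($n<\omega$, $i=0,1$) with $\mathrm{lh}(q^n_0)=\mathrm{lh}(q^n_1)$, $q^n_i(0)=i$, such that $T$ consists exactly of all initial segments of strings $r^\frown q^0_{i(0)}{}^\frown\cdots{}^\frown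 q^n_{i(n)}$, where $r=\mathrm{stem}(T)$, $n<\omega$, $i(0),\dots,i(n)\in\{0,1\}$. Put $\mathrm{spl}_0(T)=\mathrm{lh}(r)$, $\mathrm{spl}_{n+1}(T)=\mathrm{spl}_n(T)+\mathrm{lh}(q^n_0)$, and $\mathrm{spl}(T)=\{\mathrm{spl}_n(T):n<\omega\}$. -}

module Defs where

open import Data.Bool using (Bool; true; false; _xor_)
open import Data.Nat using (ℕ; zero; suc; _+_)
open import Data.List using (List; []; _∷_; _++_; length)
open import Data.List.Membership.Propositional using (_∈_)
open import Data.Product using (Σ; ∃; _×_; _,_)
open import Data.Sum using (_⊎_)
open import Data.Empty using (⊥)
open import Relation.Binary.PropositionalEquality using (_≡_; _≢_)

Str : Set
Str = List Bool

_⊑_ : Str → Str → Set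
s ⊑ t = ∃ λ u → s ++ u ≡ t

_·_ : Str → Str → Str
[] · t = t
(a ∷ s) · [] = []
(a ∷ s) · (b ∷ t) = (a xor b) ∷ (s · t)

StrSet : Set₁
StrSet = Str → Set

_≐_ : StrSet → StrSet → Set
A ≐ B = ∀ x → (A x → B x) × (B x → A x)

_∩_ : StrSet → StrSet → StrSet
(A ∩ B) x = A x × B x

_·ᵀ_ : Str → StrSet → StrSet
(s ·ᵀ T) x = ∃ λ t → T t × (s · t ≡ x)

_↾_ : StrSet → Str → StrSet
(T ↾ s) t = T t × (s ⊑ t ⊎ t ⊑ s)

Finite : StrSet → Set
Finite A = ∃ λ (L : List Str) → ∀ x → A x → x ∈ L

IsTree : StrSet → Set
IsTree T = ∀ s t → s ⊑ t → T t → T s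

IsPerfect : StrSet → Set
IsPerfect T =
  (∃ λ t → T t) ×
  IsTree T ×
  (∀ t → T t → ∃ λ b → T (t ++ (b ∷ []))) ×
  (∀ t → T t → ∃ λ s → t ⊑ s × T (s ++ (false ∷ [])) × T (s ++ (true ∷ [])))

IsStem : StrSet → Str → Set
IsStem T r = T r × (T ≐ (T ↾ r)) × (∀ s → T s → T ≐ (T ↾ s) → s ⊑ r)

path : (ℕ → Bool → Str) → (ℕ → Bool) → ℕ → Str
path q i zero = q zero (i zero)
path q i (suc n) = path q i n ++ q (suc n) (i (suc n))

head≡ : Str → Bool → Set
head≡ [] b = ⊥
head≡ (a ∷ _) b = a ≡ b

record LTData (T : StrSet) : Set where
  field
    perfect  : IsPerfect T
    r        : Str
    stem     : IsStem T r
    q        : ℕ → Bool → Str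
    q-len    : ∀ n → length (q n false) ≡ length (q n true)
    q-head   : ∀ n b → head≡ (q n b) b     -- q n b nonempty with first bit b
    q-gen    : ∀ t → (T t → ∃ λ n → ∃ λ i → t ⊑ (r ++ path q i n))
                   × ((∃ λ n → ∃ λ i → t ⊑ (r ++ path q i n)) → T t)

LT : StrSet → Set
LT T = LTData T

spl : ∀ {T} → LTData T → ℕ → ℕ
spl d zero = length (LTData.r d)
spl d (suc n) = spl d n + length (LTData.q d n false)

_∈spl_ : ∀ {T} → ℕ → LTData T → Set
h ∈spl d = ∃ λ n → spl d n ≡ h

module Submission where

-- Let T ∈ LT with stem r and splitting blocks q l false, q l true
-- (of equal length).  A choice sequence a : ℕ → Bool determines the branch
-- r ++ q 0 (a 0) ++ q 1 (a 1) ++ ⋯, and the level-n nodes of T (its strings of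
-- length spl n) are exactly the prefixes  node a n  of these branches.
--
-- The module LevelStructure then shows for T ∈ LT:
--  * (x · y) · z is a level-n node whenever x, y, z are (blockwise xor), so the
--    difference x · y of two level-n nodes, which only changes the first spl n
--    bits of a branch, preserves T.  With v = (u · v) · u this gives part (i).
--  * For part (ii) pad σ with zeros to σ′ of length N = spl (length σ); σ and σ′
--    act identically.  If T and σ · T share a string of length ≥ N, then σ′ is
--    a difference of level nodes.  Whether it is one is decidable (there are
--    finitely many level nodes): if so σ preserves T, otherwise T ∩ σ · T
--    contains only strings shorter than N and is finite.

open import Defs
open import Data.Bool using (Bool; true; false; _xor_)
open import Data.Bool.Properties using (xor-assoc; xor-comm; xor-same) renaming (_≟_ to _≟ᵇ_)
open import Data.Nat using (ℕ; zero; suc; _+_; _∸_; _≤_; _<_; z≤n; s≤s; _<?_)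
open import Data.Nat.Properties
  using (≤-refl; ≤-reflexive; <-≤-trans; <-irrefl; ≮⇒≥; m≤m+n; m≤n+m; m<m+n;
         m<n⇒m<1+n; m≤n⇒∃[o]m+o≡n; m+[n∸m]≡n; +-cancelˡ-≡; suc-injective; +-identityʳ; +-suc)
open import Data.List using (List; []; _∷_; _++_; length; replicate; map)
open import Data.List.Properties
  using (∷-injective; length-++; ++-assoc; ++-identityʳ; length-replicate; ≡-dec)
open import Data.List.Membership.Propositional using (_∈_)
open import Data.List.Membership.Propositional.Properties
  using (∈-map⁺; ∈-map⁻; ∈-++⁺ˡ; ∈-++⁺ʳ; ∈-++⁻)
open import Data.List.Membership.DecPropositional (≡-dec _≟ᵇ_) using (_∈?_)
open import Data.List.Relation.Unary.Any using (here; there)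
open import Data.Product using (∃; ∃₂; _×_; _,_; proj₁; proj₂; swap)
open import Data.Sum using (_⊎_; inj₁; inj₂)
open import Data.Empty using (⊥-elim)
open import Relation.Nullary using (Dec; yes; no)
open import Relation.Nullary.Decidable using (map′)
open import Relation.Binary.PropositionalEquality

zeros : ℕ → Str
zeros n = replicate n false

length-· : ∀ s t → length (s · t) ≡ length t
length-· [] t = refl
length-· (a ∷ s) [] = refl
length-· (a ∷ s) (b ∷ t) = cong suc (length-· s t)

·-cancel : ∀ s t → s · (s · t) ≡ t
·-cancel [] t = refl
·-cancel (a ∷ s) [] = refl
·-cancel (a ∷ s) (b ∷ t) =
  cong₂ _∷_ (trans (sym (xor-assoc a a b)) (cong (_xor b) (xor-same a))) (·-cancel s t)

·-assoc : ∀ s t u → length s ≤ length t → (s · t) · u ≡ s · (t · u)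
·-assoc [] t u _ = refl
·-assoc (a ∷ s) (b ∷ t) [] _ = refl
·-assoc (a ∷ s) (b ∷ t) (c ∷ u) (s≤s le) = cong₂ _∷_ (xor-assoc a b c) (·-assoc s t u le)

·-comm : ∀ s t → length s ≡ length t → s · t ≡ t · s
·-comm [] [] _ = refl
·-comm (a ∷ s) (b ∷ t) e = cong₂ _∷_ (xor-comm a b) (·-comm s t (suc-injective e))

·-self : ∀ s → s · s ≡ zeros (length s)
·-self [] = refl
·-self (a ∷ s) = cong₂ _∷_ (xor-same a) (·-self s)

zeros-· : ∀ n t → zeros n · t ≡ t
zeros-· zero t = refl
zeros-· (suc n) [] = refl
zeros-· (suc n) (b ∷ t) = cong (b ∷_) (zeros-· n t)

·-zeros : ∀ s → s · zeros (length s) ≡ s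
·-zeros [] = refl
·-zeros (a ∷ s) = cong₂ _∷_ (xor-comm a false) (·-zeros s)

·-pad : ∀ σ k t → σ · t ≡ (σ ++ zeros k) · t
·-pad [] k t = sym (zeros-· k t)
·-pad (a ∷ σ) k [] = refl
·-pad (a ∷ σ) k (b ∷ t) = cong ((a xor b) ∷_) (·-pad σ k t)

·-selfˡ : ∀ x y → (x · x) · y ≡ y
·-selfˡ x y = trans (cong (_· y) (·-self x)) (zeros-· (length x) y)

·-cancelʳ : ∀ x y → length x ≡ length y → (x · y) · y ≡ x
·-cancelʳ x y e = begin
  (x · y) · y          ≡⟨ ·-assoc x y y (≤-reflexive e) ⟩
  x · (y · y)          ≡⟨ cong (x ·_) (trans (·-self y) (cong zeros (sym e))) ⟩
  x · zeros (length x) ≡⟨ ·-zeros x ⟩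
  x                    ∎
  where open ≡-Reasoning

·-swap : ∀ x y → length x ≡ length y → (x · y) · x ≡ y
·-swap x y e = trans (cong (_· x) (·-comm x y e)) (·-cancelʳ y x (sym e))

·-cancelˡ : ∀ u s → length s ≡ length u → u · (s · u) ≡ s
·-cancelˡ u s e = trans (sym (·-assoc u s u (≤-reflexive (sym e)))) (·-swap u s (sym e))

·-pair : ∀ (p : Bool → Str) → length (p false) ≡ length (p true) →
         ∀ a b c → (p a · p b) · p c ≡ p ((a xor b) xor c)
·-pair p e false false c = ·-selfˡ (p false) (p c)
·-pair p e true true c = ·-selfˡ (p true) (p c)
·-pair p e false true false = ·-swap (p false) (p true) e
·-pair p e false true true = ·-cancelʳ (p false) (p true) e
·-pair p e true false true = ·-swap (p true) (p false) (sym e)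
·-pair p e true false false = ·-cancelʳ (p true) (p false) (sym e)

·-++ : ∀ a b c d → length a ≡ length c → (a ++ b) · (c ++ d) ≡ (a · c) ++ (b · d)
·-++ [] b [] d _ = refl
·-++ (x ∷ a) b (y ∷ c) d e = cong ((x xor y) ∷_) (·-++ a b c d (suc-injective e))

·-++ʳ : ∀ w x y → length w ≤ length x → w · (x ++ y) ≡ (w · x) ++ y
·-++ʳ [] x y _ = refl
·-++ʳ (a ∷ w) (b ∷ x) y (s≤s le) = cong ((a xor b) ∷_) (·-++ʳ w x y le)

⊑-refl : ∀ {s} → s ⊑ s
⊑-refl {s} = [] , ++-identityʳ s

⊑-trans : ∀ {a b c} → a ⊑ b → b ⊑ c → a ⊑ c
⊑-trans {a} (e , refl) (f , refl) = e ++ f , sym (++-assoc a e f)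

∷-⊑ : ∀ {c s t} → s ⊑ t → (c ∷ s) ⊑ (c ∷ t)
∷-⊑ (e , eq) = e , cong (_ ∷_) eq

⊑-shorter : ∀ {p x z} → p ⊑ z → x ⊑ z → length p ≤ length x → p ⊑ x
⊑-shorter {[]} {x} _ _ _ = x , refl
⊑-shorter {a ∷ p} {b ∷ x} (e , refl) (f , eq) (s≤s le) with ∷-injective eq
... | refl , eq′ = ∷-⊑ (⊑-shorter (e , refl) (f , eq′) le)

⊑-unique : ∀ {p x z} → p ⊑ z → x ⊑ z → length p ≡ length x → p ≡ x
⊑-unique {[]} {[]} _ _ _ = refl
⊑-unique {a ∷ p} {b ∷ x} (e , refl) (f , eq) len with ∷-injective eq
... | refl , eq′ = cong (a ∷_) (⊑-unique (e , refl) (f , eq′) (suc-injective len))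

·-mono : ∀ σ {s t} → s ⊑ t → (σ · s) ⊑ (σ · t)
·-mono σ {s} (e , refl) = go σ s
  where
    go : ∀ σ s → (σ · s) ⊑ (σ · (s ++ e))
    go [] s = e , refl
    go (a ∷ σ) [] = _ , refl
    go (a ∷ σ) (b ∷ s) = ∷-⊑ (go σ s)

≐-sym : ∀ {A B} → A ≐ B → B ≐ A
≐-sym e x = swap (e x)

Preserves : Str → StrSet → Set
Preserves w T = ∀ t → T t → T (w · t)

-- A preserving translation is a bijection of T, since it is an involution.
translate-invariant : ∀ {w T} → Preserves w T → (w ·ᵀ T) ≐ T
translate-invariant {w} p x =
  (λ { (t , Tt , refl) → p t Tt }) , (λ Tx → w · x , p x Tx , ·-cancel w x)

translate-restrict : ∀ {w T} u → Preserves w T → (T ↾ (w · u)) ≐ (w ·ᵀ (T ↾ u))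
translate-restrict {w} {T} u p x = forward , backward
  where
    forward : (T ↾ (w · u)) x → (w ·ᵀ (T ↾ u)) x
    forward (Tx , inj₁ le) =
      w · x , (p x Tx , inj₁ (subst (_⊑ (w · x)) (·-cancel w u) (·-mono w le))) , ·-cancel w x
    forward (Tx , inj₂ le) =
      w · x , (p x Tx , inj₂ (subst ((w · x) ⊑_) (·-cancel w u) (·-mono w le))) , ·-cancel w x
    backward : (w ·ᵀ (T ↾ u)) x → (T ↾ (w · u)) x
    backward (t , (Tt , inj₁ le) , refl) = p t Tt , inj₁ (·-mono w le)
    backward (t , (Tt , inj₂ le) , refl) = p t Tt , inj₂ (·-mono w le)

shorterThan : ℕ → List Str
shorterThan zero = []
shorterThan (suc N) = [] ∷ (map (false ∷_) (shorterThan N) ++ map (true ∷_) (shorterThan N))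

shorterThan-complete : ∀ N x → length x < N → x ∈ shorterThan N
shorterThan-complete (suc N) [] _ = here refl
shorterThan-complete (suc N) (false ∷ x) (s≤s l) =
  there (∈-++⁺ˡ (∈-map⁺ (false ∷_) (shorterThan-complete N x l)))
shorterThan-complete (suc N) (true ∷ x) (s≤s l) =
  there (∈-++⁺ʳ (map (false ∷_) (shorterThan N)) (∈-map⁺ (true ∷_) (shorterThan-complete N x l)))

module LevelStructure {T : StrSet} (d : LTData T) where
  open LTData d

  -- A choice sequence picks one of the two blocks at every splitting level.
  Choice : Set
  Choice = ℕ → Bool

  word : Choice → ℕ → Str
  word a zero = []
  word a (suc n) = word a n ++ q n (a n)

  node : Choice → ℕ → Str
  node a n = r ++ word a n

  segment : Choice → ℕ → ℕ → Str
  segment a n zero = []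
  segment a n (suc p) = segment a n p ++ q (n + p) (a (n + p))

  Node : ℕ → Str → Set
  Node n x = ∃ λ a → x ≡ node a n

  word-split : ∀ a n p → word a (n + p) ≡ word a n ++ segment a n p
  word-split a n zero rewrite +-identityʳ n = sym (++-identityʳ (word a n))
  word-split a n (suc p) rewrite +-suc n p | word-split a n p =
    ++-assoc (word a n) (segment a n p) _

  node-split : ∀ a n p → node a (n + p) ≡ node a n ++ segment a n p
  node-split a n p = trans (cong (r ++_) (word-split a n p)) (sym (++-assoc r _ _))

  node-mono : ∀ a {i j} → i ≤ j → node a i ⊑ node a j
  node-mono a {i} i≤j with m≤n⇒∃[o]m+o≡n i≤j
  ... | p , refl = segment a i p , sym (node-split a i p)

  word-ext : ∀ a b n → (∀ l → l < n → a l ≡ b l) → word a n ≡ word b n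
  word-ext a b zero _ = refl
  word-ext a b (suc n) agree =
    cong₂ _++_ (word-ext a b n (λ l l<n → agree l (m<n⇒m<1+n l<n))) (cong (q n) (agree n ≤-refl))

  segment-ext : ∀ a b n p → (∀ l → n ≤ l → a l ≡ b l) → segment a n p ≡ segment b n p
  segment-ext a b n zero _ = refl
  segment-ext a b n (suc p) agree =
    cong₂ _++_ (segment-ext a b n p agree) (cong (q (n + p)) (agree (n + p) (m≤m+n n p)))

  splice : Choice → Choice → ℕ → Choice
  splice a b n l with l <? n
  ... | yes _ = a l
  ... | no _ = b l

  splice-below : ∀ a b n l → l < n → splice a b n l ≡ a l
  splice-below a b n l l<n with l <? n
  ... | yes _ = refl
  ... | no l≮n = ⊥-elim (l≮n l<n)

  splice-above : ∀ a b n l → n ≤ l → splice a b n l ≡ b l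
  splice-above a b n l n≤l with l <? n
  ... | yes l<n = ⊥-elim (<-irrefl refl (<-≤-trans l<n n≤l))
  ... | no _ = refl

  node-splice : ∀ a b n p → node a n ++ segment b n p ≡ node (splice a b n) (n + p)
  node-splice a b n p = begin
    node a n ++ segment b n p
      ≡⟨ ++-assoc r _ _ ⟩
    r ++ (word a n ++ segment b n p)
      ≡⟨ cong (r ++_) (cong₂ _++_ (sym (word-ext _ _ n (splice-below a b n)))
                                  (sym (segment-ext _ _ n p (splice-above a b n)))) ⟩
    r ++ (word c n ++ segment c n p)
      ≡⟨ cong (r ++_) (sym (word-split c n p)) ⟩
    node c (n + p) ∎
    where
      open ≡-Reasoning
      c = splice a b n

  node-extend : ∀ n {x} → Node n x → ∀ b → Node (suc n) (x ++ q n b)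
  node-extend n (a , refl) b = splice a (λ _ → b) n , (begin
    (r ++ word a n) ++ q n b
      ≡⟨ ++-assoc r _ _ ⟩
    r ++ (word a n ++ q n b)
      ≡⟨ cong (r ++_) (cong₂ _++_ (sym (word-ext _ _ n (splice-below a _ n)))
                                  (cong (q n) (sym (splice-above a _ n n ≤-refl)))) ⟩
    node (splice a (λ _ → b) n) (suc n) ∎)
    where open ≡-Reasoning

  q-length : ∀ l b → length (q l b) ≡ length (q l false)
  q-length l false = refl
  q-length l true = sym (q-len l)

  node-length : ∀ a n → length (node a n) ≡ spl d n
  node-length a zero = trans (length-++ r) (+-identityʳ _)
  node-length a (suc n) = begin
    length (r ++ (word a n ++ q n (a n)))
      ≡⟨ cong length (sym (++-assoc r (word a n) _)) ⟩
    length (node a n ++ q n (a n))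
      ≡⟨ length-++ (node a n) ⟩
    length (node a n) + length (q n (a n))
      ≡⟨ cong₂ _+_ (node-length a n) (q-length n (a n)) ⟩
    spl d (suc n) ∎
    where open ≡-Reasoning

  word-length : ∀ a b n → length (word a n) ≡ length (word b n)
  word-length a b n = +-cancelˡ-≡ (length r) _ _
    (trans (sym (length-++ r)) (trans (node-length a n) (trans (sym (node-length b n)) (length-++ r))))

  Node-length : ∀ n {x} → Node n x → length x ≡ spl d n
  Node-length n (a , refl) = node-length a n

  n≤spl : ∀ n → n ≤ spl d n
  n≤spl zero = z≤n
  n≤spl (suc n) = <-≤-trans (s≤s (n≤spl n)) (m<m+n (spl d n) (nonempty (q n false) (q-head n false)))
    where
      nonempty : ∀ s → head≡ s false → 0 < length s
      nonempty (_ ∷ _) _ = s≤s z≤n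

  isTree : IsTree T
  isTree = proj₁ (proj₂ perfect)

  path≡word : ∀ a m → path q a m ≡ word a (suc m)
  path≡word a zero = refl
  path≡word a (suc m) = cong (_++ q (suc m) (a (suc m))) (path≡word a m)

  node∈T : ∀ a n → T (node a n)
  node∈T a n = proj₂ (q-gen _)
    (n , a , q n (a n) , trans (++-assoc r (word a n) _) (cong (r ++_) (sym (path≡word a n))))

  below-node : ∀ {t} → T t → ∀ n → ∃₂ λ a p → t ⊑ node a (n + p)
  below-node {t} Tt n with proj₁ (q-gen t) Tt
  ... | m , a , t⊑ = a , suc m ,
    ⊑-trans (subst (λ z → t ⊑ (r ++ z)) (path≡word a m) t⊑) (node-mono a (m≤n+m (suc m) n))

  node-prefix : ∀ {x} n → T x → spl d n ≤ length x → ∃ λ a → node a n ⊑ x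
  node-prefix {x} n Tx long with below-node Tx n
  ... | a , p , x⊑ =
    a , ⊑-shorter (node-mono a (m≤m+n n p)) x⊑ (subst (_≤ length x) (sym (node-length a n)) long)

  level-node : ∀ {x} n → T x → length x ≡ spl d n → Node n x
  level-node {x} n Tx len with node-prefix n Tx (≤-reflexive (sym len))
  ... | a , a⊑x = a , sym (⊑-unique a⊑x ⊑-refl (trans (node-length a n) (sym len)))

  -- Combining three level-n nodes by (x · y) · z gives a level-n node: in
  -- each block it is ·-pair, so the choices combine by xor.
  xor3 : Choice → Choice → Choice → Choice
  xor3 a b c l = (a l xor b l) xor c l

  word-xor3 : ∀ a b c n → (word a n · word b n) · word c n ≡ word (xor3 a b c) n
  word-xor3 a b c zero = refl
  word-xor3 a b c (suc n) = begin
    ((word a n ++ q n (a n)) · (word b n ++ q n (b n))) · (word c n ++ q n (c n))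
      ≡⟨ cong (_· (word c n ++ q n (c n))) (·-++ (word a n) _ (word b n) _ (word-length a b n)) ⟩
    ((word a n · word b n) ++ (q n (a n) · q n (b n))) · (word c n ++ q n (c n))
      ≡⟨ ·-++ (word a n · word b n) _ (word c n) _
              (trans (length-· (word a n) (word b n)) (word-length b c n)) ⟩
    ((word a n · word b n) · word c n) ++ ((q n (a n) · q n (b n)) · q n (c n))
      ≡⟨ cong₂ _++_ (word-xor3 a b c n) (·-pair (q n) (q-len n) (a n) (b n) (c n)) ⟩
    word (xor3 a b c) (suc n) ∎
    where open ≡-Reasoning

  node-xor3 : ∀ n {x y z} → Node n x → Node n y → Node n z → Node n ((x · y) · z)
  node-xor3 n (a , refl) (b , refl) (c , refl) = xor3 a b c , (begin
    ((r ++ word a n) · (r ++ word b n)) · (r ++ word c n)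
      ≡⟨ cong (_· (r ++ word c n)) (·-++ r _ r _ refl) ⟩
    ((r · r) ++ (word a n · word b n)) · (r ++ word c n)
      ≡⟨ ·-++ (r · r) _ r _ (length-· r r) ⟩
    ((r · r) · r) ++ ((word a n · word b n) · word c n)
      ≡⟨ cong₂ _++_ (·-selfˡ r r) (word-xor3 a b c n) ⟩
    node (xor3 a b c) n ∎)
    where open ≡-Reasoning

  -- The difference of two level-n nodes preserves T: it changes only the
  -- first spl n bits of a branch, turning its level-n node into another one.
  node-difference-preserves : ∀ n {x y} → Node n x → Node n y → Preserves (x · y) T
  node-difference-preserves n {x} {y} nx ny t Tt with below-node Tt n
  ... | a , p , t⊑ = isTree _ _ (subst ((w · t) ⊑_) moved (·-mono w t⊑)) (node∈T _ (n + p))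
    where
      w = x · y
      c = proj₁ (node-xor3 n nx ny (a , refl))
      moved : w · node a (n + p) ≡ node (splice c a n) (n + p)
      moved = begin
        w · node a (n + p)                ≡⟨ cong (w ·_) (node-split a n p) ⟩
        w · (node a n ++ segment a n p)   ≡⟨ ·-++ʳ w _ _ (≤-reflexive (trans (length-· x y)
                                               (trans (Node-length n ny) (sym (node-length a n))))) ⟩
        (w · node a n) ++ segment a n p   ≡⟨ cong (_++ segment a n p) (proj₂ (node-xor3 n nx ny (a , refl))) ⟩
        node c n ++ segment a n p         ≡⟨ node-splice c a n p ⟩
        node (splice c a n) (n + p)       ∎
        where open ≡-Reasoning

  meeting⇒difference : ∀ n {σ t} → length σ ≡ spl d n → T t → T (σ · t) → spl d n ≤ length t →
                       ∃₂ λ x y → Node n x × Node n y × σ ≡ x · y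
  meeting⇒difference n {σ} {t} lσ Tt Tσt long
    with node-prefix n Tt long
       | node-prefix n Tσt (subst (spl d n ≤_) (sym (length-· σ t)) long)
  ... | b , b⊑t | a , a⊑σt = node a n , node b n , (a , refl) , (b , refl) , (begin
    σ                          ≡⟨ sym (·-cancelʳ σ (node b n) (trans lσ (sym (node-length b n)))) ⟩
    (σ · node b n) · node b n  ≡⟨ cong (_· node b n) σb≡a ⟩
    node a n · node b n        ∎)
    where
      open ≡-Reasoning
      σb≡a : σ · node b n ≡ node a n
      σb≡a = ⊑-unique (·-mono σ b⊑t) a⊑σt
               (trans (length-· σ (node b n)) (trans (node-length b n) (sym (node-length a n))))

  levelNodes : ℕ → List Str
  levelNodes zero = r ∷ []
  levelNodes (suc n) = map (_++ q n false) (levelNodes n) ++ map (_++ q n true) (levelNodes n)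

  levelNodes-complete : ∀ a n → node a n ∈ levelNodes n
  levelNodes-complete a zero = here (++-identityʳ r)
  levelNodes-complete a (suc n) = subst (_∈ levelNodes (suc n)) (++-assoc r (word a n) _) (extend (a n))
    where
      extend : ∀ b → node a n ++ q n b ∈ levelNodes (suc n)
      extend false = ∈-++⁺ˡ (∈-map⁺ (_++ q n false) (levelNodes-complete a n))
      extend true = ∈-++⁺ʳ (map (_++ q n false) (levelNodes n)) (∈-map⁺ (_++ q n true) (levelNodes-complete a n))

  levelNodes-sound : ∀ n x → x ∈ levelNodes n → Node n x
  levelNodes-sound zero x (here refl) = (λ _ → false) , sym (++-identityʳ r)
  levelNodes-sound (suc n) x x∈ with ∈-++⁻ (map (_++ q n false) (levelNodes n)) x∈
  ... | inj₁ x∈₀ with ∈-map⁻ (_++ q n false) x∈₀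
  ...   | y , y∈ , refl = node-extend n (levelNodes-sound n y y∈) false
  levelNodes-sound (suc n) x x∈ | inj₂ x∈₁ with ∈-map⁻ (_++ q n true) x∈₁
  ...   | y , y∈ , refl = node-extend n (levelNodes-sound n y y∈) true

  Node? : ∀ n x → Dec (Node n x)
  Node? n x = map′ (levelNodes-sound n x) (λ { (a , refl) → levelNodes-complete a n }) (x ∈? levelNodes n)

  level-symmetry : ∀ n {u v} → Node n u → Node n v →
                   ((T ↾ v) ≐ ((u · v) ·ᵀ (T ↾ u))) × (((u · v) ·ᵀ T) ≐ T)
  level-symmetry n {u} {v} nu nv =
    subst (λ z → (T ↾ z) ≐ ((u · v) ·ᵀ (T ↾ u))) (·-swap u v same-length) (translate-restrict u preserves)
    , translate-invariant preserves
    where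
      preserves : Preserves (u · v) T
      preserves = node-difference-preserves n nu nv
      same-length : length u ≡ length v
      same-length = trans (Node-length n nu) (sym (Node-length n nv))

  -- Part (ii).  σ′ is σ padded to length N = spl n with n = length σ, and u is
  -- a fixed level-n node; σ is a node difference iff σ′ · u is a node.
  translate-dichotomy : ∀ σ → (T ≐ (σ ·ᵀ T)) ⊎ Finite (T ∩ (σ ·ᵀ T))
  translate-dichotomy σ = decide (Node? n (σ′ · u))
    where
      n = length σ
      N = spl d n
      σ′ = σ ++ zeros (N ∸ n)
      u = node (λ _ → false) n

      σ′-length : length σ′ ≡ N
      σ′-length = trans (length-++ σ) (trans (cong (n +_) (length-replicate (N ∸ n))) (m+[n∸m]≡n (n≤spl n)))

      decide : Dec (Node n (σ′ · u)) → (T ≐ (σ ·ᵀ T)) ⊎ Finite (T ∩ (σ ·ᵀ T))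
      decide (yes σ′u-node) = inj₁ (≐-sym (translate-invariant σ-preserves))
        where
          σ-preserves : Preserves σ T
          σ-preserves t Tt = subst T (sym (·-pad σ (N ∸ n) t))
            (subst (λ z → T (z · t)) (·-cancelˡ u σ′ (trans σ′-length (sym (node-length _ n))))
              (node-difference-preserves n (_ , refl) σ′u-node t Tt))
      decide (no ¬σ′u-node) = inj₂ (shorterThan N , short)
        where
          short : ∀ x → (T ∩ (σ ·ᵀ T)) x → x ∈ shorterThan N
          short x (Tx , t , Tt , refl) with length (σ · t) <? N
          ... | yes σt-short = shorterThan-complete N _ σt-short
          ... | no σt-long with meeting⇒difference n σ′-length Tt (subst T (·-pad σ (N ∸ n) t) Tx)
                                  (subst (N ≤_) (length-· σ t) (≮⇒≥ σt-long))
          ...   | x , y , nx , ny , σ′≡x·y =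
                  ⊥-elim (¬σ′u-node (subst (λ z → Node n (z · u)) (sym σ′≡x·y) (node-xor3 n nx ny (_ , refl))))

lemma2p1 : (T : StrSet) (d : LT T) (h : ℕ) → h ∈spl d →
    (∀ u v → length u ≡ h → T u → length v ≡ h → T v →
      ((T ↾ v) ≐ ((u · v) ·ᵀ (T ↾ u))) × (((u · v) ·ᵀ T) ≐ T))
    × (∀ (σ : Str) → (T ≐ (σ ·ᵀ T)) ⊎ Finite (T ∩ (σ ·ᵀ T)))
lemma2p1 T d h (n , refl) = part-i , translate-dichotomy
  where
    open LevelStructure d
    part-i : ∀ u v → length u ≡ spl d n → T u → length v ≡ spl d n → T v →
             ((T ↾ v) ≐ ((u · v) ·ᵀ (T ↾ u))) × (((u · v) ·ᵀ T) ≐ T)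
    part-i u v lu Tu lv Tv = level-symmetry n (level-node n Tu lu) (level-node n Tv lv)
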